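{- Let $n,c,k$ be positive integers with $kc\le\lfloor n/2\rfloor$, and let $G=Ci(n,\{c,2c,\dots,kc\})$. Then $G$ is closed distance magic if and only if either $n=2kc$, or $n=(2k+1)c$ and $c$ is odd.
   Context: For $S\subseteq\{1,\dots,\lfloor n/2\rfloor\}$, the circulant graph $Ci(n,S)$ has vertex set $\{v_0,\dots,v_{n-1}\}$, with $v_i$ adjacent to $v_j$ iff $|i-j|\in S$ (equivalently, the cyclic distance of $i$ and $j$ modulo $n$ lies in $S$). A graph on $n$ vertices is closed distance magic if there is a bijection $\ell\colon V\to\{1,\dots,n\}$ and a positive integer $k'$ such that for every vertex $x$, the sum of $\ell(y)$ over all $y$ in the closed neighborhood $N[x]$ ($x$ together with its neighbors) equals $k'$. -}

module Defs where

open import Data.Nat using (ℕ; zero; suc; _+_; _*_; _∸_; _≤_; _<_; _≤ᵇ_; _≡ᵇ_)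
open import Data.Nat.Properties using (_≟_)
open import Data.Bool using (Bool; true; false; if_then_else_; _∨_; _∧_)
open import Data.Fin using (Fin; toℕ)
open import Data.Fin.Properties using () renaming (_≟_ to _≟ᶠ_)
open import Data.List using (List)
open import Data.Bool.ListAction using (any)
open import Data.List using (map; sum; upTo)
open import Data.Product using (Σ; ∃; _×_)
open import Data.Vec.Functional using (Vector)
import Data.Vec.Functional as VF
open import Function.Bundles using (_⤖_; Bijection)
open import Relation.Nullary.Decidable using (⌊_⌋)
open import Relation.Binary.PropositionalEquality using (_≡_)

absDiff : ℕ → ℕ → ℕ
absDiff a b = (a ∸ b) + (b ∸ a)

min' : ℕ → ℕ → ℕ
min' a b = if a ≤ᵇ b then a else b

cycDist : (n : ℕ) → ℕ → ℕ → ℕ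
cycDist n i j = min' (absDiff i j) (n ∸ absDiff i j)

-- A connection set S is given as a Boolean membership test on ℕ.
-- Circulant graph Ci(n,S): vertices Fin n, v_i ~ v_j iff the cyclic
-- distance of i and j lies in S.
CiAdj : (n : ℕ) → (S : ℕ → Bool) → Fin n → Fin n → Bool
CiAdj n S i j = S (cycDist n (toℕ i) (toℕ j))

inClosedNbhd : (n : ℕ) → (S : ℕ → Bool) → Fin n → Fin n → Bool
inClosedNbhd n S x y = ⌊ x ≟ᶠ y ⌋ ∨ CiAdj n S x y

ΣFin : (n : ℕ) → (Fin n → ℕ) → ℕ
ΣFin n f = VF.foldr _+_ 0 f

-- closed neighbourhood label sum, with label of v equal to ℓ(v)+1 ∈ {1..n}
closedNbhdSum : (n : ℕ) → (S : ℕ → Bool) → (Fin n ⤖ Fin n) → Fin n → ℕ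
closedNbhdSum n S ℓ x =
  ΣFin n (λ y → if inClosedNbhd n S x y then suc (toℕ (Bijection.to ℓ y)) else 0)

-- closed distance magic: a bijection ℓ : V → {1..n} (encoded as a
-- bijection Fin n ⤖ Fin n, shifted by one) and a positive k' with
-- every closed neighbourhood sum equal to k'.
ClosedDistanceMagic : (n : ℕ) → (S : ℕ → Bool) → Set
ClosedDistanceMagic n S =
  Σ (Fin n ⤖ Fin n) λ ℓ → Σ ℕ λ k' → (0 < k') × (∀ x → closedNbhdSum n S ℓ x ≡ k')

multSet : (c k : ℕ) → ℕ → Bool
multSet c k d = any (λ m → d ≡ᵇ (suc m * c)) (upTo k)

-- For 2kc < n the closed neighbourhoods of v₀ and v_c differ in one vertex each: N[v_c] is N[v₀]
-- with v_{n-kc} exchanged for v_{(k+1)c}. Comparing their magic sums, a closed distance magic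
-- labelling gives these two vertices the same label, so n - kc = (k+1)c.
-- When c ∣ n and 2kc ≤ n ≤ (2k+1)c the closed neighbourhoods are exactly the residue classes
-- modulo c; adding the magic equations of v₀, …, v_{c-1} counts every label once, so
-- c k' = n(n+1)/2, which for n = (2k+1)c forces c to be odd.
-- Conversely, labelling j c + s by j c + σ_j(s) is magic whenever the rows σ_j form a Kotzig
-- array: permutations of {0, …, c-1} with constant column sums. Such arrays exist with any even
-- number of rows (a row next to its reverse), and with any odd number of rows when c = 2h + 1
-- (the rows s, s + h and 2h - 2s modulo c, with column sums 3h, followed by reversed pairs).
module Submission where

open import Defs
open import Data.Nat using (ℕ; _*_; _+_; _/_; _%_; _<_; _≤_; suc)
open import Data.Product using (_×_)
open import Data.Sum using (_⊎_)
open import Function.Bundles using (_⇔_)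
open import Relation.Binary.PropositionalEquality using (_≡_)

open import Data.Bool using (Bool; true; false; if_then_else_; T)
open import Data.Bool.Properties using (T-∨)
open import Data.Empty using (⊥-elim)
open import Data.Fin as Fin using (Fin; toℕ; fromℕ<; combine; remQuot; _↑ˡ_; _↑ʳ_; opposite)
import Data.Fin.Properties as Finₚ
open import Data.List using (upTo)
open import Data.List.Membership.Propositional using (find; lose)
open import Data.List.Membership.Propositional.Properties using (∈-upTo⁺; ∈-upTo⁻)
open import Data.List.Relation.Unary.Any.Properties using (any⁺; any⁻)
open import Data.Nat
open import Data.Nat.DivMod
open import Data.Nat.Divisibility
open import Data.Nat.Properties
open import Data.Nat.Tactic.RingSolver using (solve-∀)
open import Data.Product using (∃-syntax; _,_; proj₁; uncurry)
import Data.Product as Product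
open import Data.Product.Function.NonDependent.Propositional using (_×-⇔_)
open import Data.Sum using (inj₁; inj₂; [_,_])
open import Data.Sum.Function.Propositional using (_⊎-⇔_)
open import Function using (_∘_; id; Injective)
open import Function.Bundles using (_⤖_; Bijection; mk⤖; mk⇔; Equivalence)
open import Function.Properties.Bijection using (⤖⇒↔)
import Function.Properties.Equivalence as ⇔
open import Relation.Binary.PropositionalEquality
  using (_≢_; refl; sym; trans; cong; cong₂; subst; subst₂; module ≡-Reasoning)
open import Relation.Nullary using (¬_; yes; no; contradiction)
open import Relation.Nullary.Decidable using (⌊_⌋; toWitness; fromWitness)
open import Algebra.Properties.CommutativeMonoid.Sum +-0-commutativeMonoid
  using (sum-cong-≗; ∑-distrib-+; ∑-comm; sum-permute)

¬-⇔ : ∀ {A B : Set} → A ⇔ B → (¬ A) ⇔ (¬ B)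
¬-⇔ A⇔B = mk⇔ (_∘ Equivalence.from A⇔B) (_∘ Equivalence.to A⇔B)

T-injective : ∀ {a b} → T a ⇔ T b → a ≡ b
T-injective {true}  {true}  _   = refl
T-injective {true}  {false} a⇔b = ⊥-elim (Equivalence.to a⇔b _)
T-injective {false} {true}  a⇔b = ⊥-elim (Equivalence.from a⇔b _)
T-injective {false} {false} _   = refl

≡ᵇ⇔≡ : ∀ {a b} → T (a ≡ᵇ b) ⇔ a ≡ b
≡ᵇ⇔≡ = mk⇔ (≡ᵇ⇒≡ _ _) (≡⇒≡ᵇ _ _)

≡ᵇ-comm : ∀ a b → (a ≡ᵇ b) ≡ (b ≡ᵇ a)
≡ᵇ-comm zero    zero    = refl
≡ᵇ-comm zero    (suc b) = refl
≡ᵇ-comm (suc a) zero    = refl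
≡ᵇ-comm (suc a) (suc b) = ≡ᵇ-comm a b

if-balance : ∀ {a α b β : Bool} v → (T b ⇔ (T α ⊎ (T a × ¬ T β))) → (T β → T a) → (T α → T a → T β) →
             (if a then v else 0) + (if α then v else 0) ≡ (if b then v else 0) + (if β then v else 0)
if-balance {true}  {true}  {true}  {true}  v _  _   _     = refl
if-balance {true}  {true}  {true}  {false} v _  _   α⇒a⇒β = ⊥-elim (α⇒a⇒β _ _)
if-balance {true}  {true}  {false}         v b⇔ _   _     = ⊥-elim (Equivalence.from b⇔ (inj₁ _))
if-balance {true}  {false} {true}  {true}  v b⇔ _   _     = ⊥-elim ([ id , (λ (_ , ¬β) → ¬β _) ] (Equivalence.to b⇔ _))
if-balance {true}  {false} {true}  {false} v _  _   _     = refl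
if-balance {true}  {false} {false} {true}  v _  _   _     = +-identityʳ v
if-balance {true}  {false} {false} {false} v b⇔ _   _     = ⊥-elim (Equivalence.from b⇔ (inj₂ (_ , id)))
if-balance {false} {true}  {true}  {true}  v _  β⇒a _     = ⊥-elim (β⇒a _)
if-balance {false} {true}  {true}  {false} v _  _   _     = sym (+-identityʳ v)
if-balance {false} {true}  {false}         v b⇔ _   _     = ⊥-elim (Equivalence.from b⇔ (inj₁ _))
if-balance {false} {false} {true}          v b⇔ _   _     = ⊥-elim ([ id , proj₁ ] (Equivalence.to b⇔ _))
if-balance {false} {false} {false} {true}  v _  β⇒a _     = ⊥-elim (β⇒a _)
if-balance {false} {false} {false} {false} v _  _   _     = refl

m∸[n∸o]≡m∸n+o : ∀ {m n o} → o ≤ n → n ≤ m → m ∸ (n ∸ o) ≡ (m ∸ n) + o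
m∸[n∸o]≡m∸n+o {m} {n} {o} o≤n n≤m = begin
  m ∸ (n ∸ o)              ≡⟨ cong (_∸ (n ∸ o)) (m∸n+n≡m n≤m) ⟨
  (m ∸ n) + n ∸ (n ∸ o)    ≡⟨ +-∸-assoc (m ∸ n) (m∸n≤m n o) ⟩
  (m ∸ n) + (n ∸ (n ∸ o))  ≡⟨ cong ((m ∸ n) +_) (m∸[m∸n]≡n o≤n) ⟩
  (m ∸ n) + o              ∎
  where open ≡-Reasoning

∣∸⇒%≡% : ∀ c .{{_ : NonZero c}} {a b} → b ≤ a → c ∣ a ∸ b → a % c ≡ b % c
∣∸⇒%≡% c {a} {b} b≤a c∣a∸b = trans (cong (_% c) (sym (m∸n+n≡m b≤a))) (%-remove-+ˡ b c∣a∸b)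

%≡%⇒∣∸ : ∀ c .{{_ : NonZero c}} a b → a % c ≡ b % c → c ∣ a ∸ b
%≡%⇒∣∸ c a b a%c≡b%c = divides (a / c ∸ b / c) (begin
  a ∸ b                                      ≡⟨ cong₂ _∸_ (m≡m%n+[m/n]*n a c)
                                                (trans (m≡m%n+[m/n]*n b c) (cong (_+ b / c * c) (sym a%c≡b%c))) ⟩
  (a % c + a / c * c) ∸ (a % c + b / c * c)  ≡⟨ [m+n]∸[m+o]≡n∸o (a % c) _ _ ⟩
  a / c * c ∸ b / c * c                      ≡⟨ *-distribʳ-∸ c (a / c) (b / c) ⟨
  (a / c ∸ b / c) * c                        ∎)
  where open ≡-Reasoning

∣∣-∣⇔%≡% : ∀ c .{{_ : NonZero c}} a b → c ∣ ∣ a - b ∣ ⇔ a % c ≡ b % c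
∣∣-∣⇔%≡% c a b with ≤-total a b
... | inj₁ a≤b rewrite m≤n⇒∣m-n∣≡n∸m a≤b = mk⇔ (sym ∘ ∣∸⇒%≡% c a≤b) (%≡%⇒∣∸ c b a ∘ sym)
... | inj₂ b≤a rewrite m≤n⇒∣n-m∣≡n∸m b≤a = mk⇔ (∣∸⇒%≡% c b≤a)       (%≡%⇒∣∸ c a b)

ΣFin-const : ∀ n v → ΣFin n (λ _ → v) ≡ n * v
ΣFin-const zero    v = refl
ΣFin-const (suc n) v = cong (v +_) (ΣFin-const n v)

ΣFin-indicator : ∀ n a (a<n : a < n) (f : Fin n → ℕ) →
                 ΣFin n (λ y → if toℕ y ≡ᵇ a then f y else 0) ≡ f (fromℕ< a<n)
ΣFin-indicator (suc n) zero    _         f =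
  trans (cong (f Fin.zero +_) (trans (ΣFin-const n 0) (*-zeroʳ n))) (+-identityʳ _)
ΣFin-indicator (suc n) (suc a) (s≤s a<n) f = ΣFin-indicator n a a<n (f ∘ Fin.suc)

ΣFin-splitAt : ∀ a b (f : Fin (a + b) → ℕ) →
          ΣFin (a + b) f ≡ ΣFin a (f ∘ (_↑ˡ b)) + ΣFin b (f ∘ (a ↑ʳ_))
ΣFin-splitAt zero    b f = refl
ΣFin-splitAt (suc a) b f =
  trans (cong (f Fin.zero +_) (ΣFin-splitAt a b (f ∘ Fin.suc))) (sym (+-assoc (f Fin.zero) _ _))

ΣFin-combine : ∀ m c (f : Fin (m * c) → ℕ) →
               ΣFin (m * c) f ≡ ΣFin m (λ j → ΣFin c (λ s → f (combine j s)))
ΣFin-combine zero    c f = refl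
ΣFin-combine (suc m) c f =
  trans (ΣFin-splitAt c (m * c) f) (cong (ΣFin c (f ∘ (_↑ˡ m * c)) +_) (ΣFin-combine m c (f ∘ (c ↑ʳ_))))

ΣFin-bijection : ∀ n (π : Fin n ⤖ Fin n) (g : Fin n → ℕ) → ΣFin n (g ∘ Bijection.to π) ≡ ΣFin n g
ΣFin-bijection n π g = sym (sum-permute g (⤖⇒↔ π))

2*ΣFin[a+i]+n≡n[2a+n] : ∀ n a → 2 * ΣFin n (λ y → a + toℕ y) + n ≡ n * (2 * a + n)
2*ΣFin[a+i]+n≡n[2a+n] zero    a = refl
2*ΣFin[a+i]+n≡n[2a+n] (suc n) a = begin
  2 * (a + 0 + ΣFin n (λ y → a + suc (toℕ y))) + suc n
    ≡⟨ cong (λ s → 2 * (a + 0 + s) + suc n) (sum-cong-≗ {n} (λ y → +-suc a (toℕ y))) ⟩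
  2 * (a + 0 + ΣFin n (λ y → suc a + toℕ y)) + suc n
    ≡⟨ shuffle a n (ΣFin n (λ y → suc a + toℕ y)) ⟩
  2 * a + 1 + (2 * ΣFin n (λ y → suc a + toℕ y) + n)
    ≡⟨ cong (2 * a + 1 +_) (2*ΣFin[a+i]+n≡n[2a+n] n (suc a)) ⟩
  2 * a + 1 + n * (2 * suc a + n)
    ≡⟨ expand a n ⟩
  suc n * (2 * a + suc n) ∎
  where
  open ≡-Reasoning
  shuffle : ∀ a n s → 2 * (a + 0 + s) + suc n ≡ 2 * a + 1 + (2 * s + n)
  shuffle = solve-∀
  expand : ∀ a n → 2 * a + 1 + n * (2 * suc a + n) ≡ suc n * (2 * a + suc n)
  expand = solve-∀

2*ΣFin[1+i]≡n[1+n] : ∀ n → 2 * ΣFin n (λ y → suc (toℕ y)) ≡ n * suc n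
2*ΣFin[1+i]≡n[1+n] n = +-cancelʳ-≡ n _ _ (trans (2*ΣFin[a+i]+n≡n[2a+n] n 1) (expand n))
  where
  expand : ∀ n → n * (2 * 1 + n) ≡ n * suc n + n
  expand = solve-∀

Fin-injective⇒surjective : ∀ {n} (f : Fin n → Fin n) → Injective _≡_ _≡_ f → ∀ y → ∃[ x ] f x ≡ y
Fin-injective⇒surjective {suc n} f f-inj y with Finₚ.any? (λ x → f x Finₚ.≟ y)
... | yes hit = hit
... | no  miss with Finₚ.pigeonhole (n<1+n n) (λ x → Fin.punchOut (miss ∘ (x ,_) ∘ sym))
... | i , j , i<j , same = contradiction
      (f-inj (Finₚ.punchOut-injective (miss ∘ (i ,_) ∘ sym) (miss ∘ (j ,_) ∘ sym) same)) (Finₚ.<⇒≢ i<j)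

HasMagicConstant : (n : ℕ) → (ℕ → Bool) → (Fin n ⤖ Fin n) → ℕ → Set
HasMagicConstant n S ℓ k' = ∀ x → closedNbhdSum n S ℓ x ≡ k'

Multiple≤ : ℕ → ℕ → ℕ → Set
Multiple≤ k c d = ∃[ m ] m ≤ k × d ≡ m * c

multSet⇒Multiple≤ : ∀ c k d → T (multSet c k d) → Multiple≤ k c d
multSet⇒Multiple≤ c k d t with find (any⁻ (λ m → d ≡ᵇ suc m * c) (upTo k) t)
... | m , m∈upTo , d≡ = suc m , ∈-upTo⁻ m∈upTo , ≡ᵇ⇒≡ d (suc m * c) d≡

Multiple≤⇒multSet : ∀ c k d → 0 < d → Multiple≤ k c d → T (multSet c k d)
Multiple≤⇒multSet c k d 0<d (zero  , _   , d≡0) = contradiction d≡0 (>⇒≢ 0<d)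
Multiple≤⇒multSet c k d 0<d (suc m , m<k , d≡) =
  any⁺ (λ m → d ≡ᵇ suc m * c) (lose (∈-upTo⁺ m<k) (≡⇒≡ᵇ d (suc m * c) d≡))

Multiple≤-zero : ∀ k c → Multiple≤ k c 0
Multiple≤-zero k c = 0 , z≤n , refl

Multiple≤-top : ∀ k c → Multiple≤ k c (k * c)
Multiple≤-top k c = k , ≤-refl , refl

Multiple≤-max : ∀ {k c d} → Multiple≤ k c d → d ≤ k * c
Multiple≤-max {c = c} (m , m≤k , refl) = *-monoˡ-≤ c m≤k

Multiple≤-below : ∀ {k c d} → d < c → Multiple≤ k c d → d ≡ 0
Multiple≤-below d<c (zero  , _ , d≡0) = d≡0
Multiple≤-below {c = c} d<c (suc m , _ , refl) = contradiction (m≤m+n c (m * c)) (<⇒≱ d<c)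

Multiple≤-+c⇒ : ∀ {k c s} → 0 < c → Multiple≤ k c (s + c) → Multiple≤ k c s × s ≢ k * c
Multiple≤-+c⇒ {c = c} {s} 0<c (zero , _ , s+c≡0) =
  contradiction (subst (c ≤_) s+c≡0 (m≤n+m c s)) (<⇒≱ 0<c)
Multiple≤-+c⇒ {k} {c} {s} 0<c (suc m , m<k , s+c≡) =
  (m , <⇒≤ m<k , s≡mc) , λ s≡kc → <⇒≢ m<k (*-cancelʳ-≡ m k c (trans (sym s≡mc) s≡kc))
  where
  instance _ = >-nonZero 0<c
  s≡mc : s ≡ m * c
  s≡mc = +-cancelʳ-≡ c s (m * c) (trans s+c≡ (+-comm c (m * c)))

Multiple≤-+c⇐ : ∀ {k c s} → Multiple≤ k c s → s ≢ k * c → Multiple≤ k c (s + c)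
Multiple≤-+c⇐ {k} {c} (m , m≤k , refl) s≢kc =
  suc m , ≤∧≢⇒< m≤k (λ m≡k → s≢kc (cong (_* c) m≡k)) , +-comm (m * c) c

Multiple≤-balanced : ∀ {k c x y} → x ≤ y → Multiple≤ k c y → k * c + k * c ≤ x + y → x ≡ k * c
Multiple≤-balanced {k} {c} {x} {y} x≤y my 2kc≤x+y =
  ≤-antisym (≤-trans x≤y y≤kc) (≮⇒≥ λ x<kc → <⇒≱ (+-mono-<-≤ x<kc y≤kc) 2kc≤x+y)
  where y≤kc = Multiple≤-max my

Multiple≤-⊓ : ∀ {k c x y} → k * c + k * c ≤ x + y →
              Multiple≤ k c x ⊎ Multiple≤ k c y → Multiple≤ k c (x ⊓ y)
Multiple≤-⊓ {k} {c} {x} {y} 2kc≤x+y m with ≤-total x y | m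
... | inj₁ x≤y | inj₁ mx = subst (Multiple≤ k c) (sym (m≤n⇒m⊓n≡m x≤y)) mx
... | inj₁ x≤y | inj₂ my = subst (Multiple≤ k c) (sym (trans (m≤n⇒m⊓n≡m x≤y)
                             (Multiple≤-balanced x≤y my 2kc≤x+y))) (Multiple≤-top k c)
... | inj₂ y≤x | inj₁ mx = subst (Multiple≤ k c) (sym (trans (m≥n⇒m⊓n≡n y≤x)
                             (Multiple≤-balanced y≤x mx (subst (k * c + k * c ≤_) (+-comm x y) 2kc≤x+y))))
                             (Multiple≤-top k c)
... | inj₂ y≤x | inj₂ my = subst (Multiple≤ k c) (sym (m≥n⇒m⊓n≡n y≤x)) my

absDiff≡∣-∣ : ∀ a b → absDiff a b ≡ ∣ a - b ∣
absDiff≡∣-∣ zero    zero    = refl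
absDiff≡∣-∣ zero    (suc b) = refl
absDiff≡∣-∣ (suc a) zero    = +-identityʳ (suc a)
absDiff≡∣-∣ (suc a) (suc b) = absDiff≡∣-∣ a b

min'≡⊓ : ∀ a b → min' a b ≡ a ⊓ b
min'≡⊓ a b with a ≤ᵇ b in eq
... | true  = sym (m≤n⇒m⊓n≡m (≤ᵇ⇒≤ a b (subst T (sym eq) _)))
... | false = sym (m≥n⇒m⊓n≡n (<⇒≤ (≰⇒> (λ a≤b → subst T eq (≤⇒≤ᵇ a≤b)))))

module ClosedNeighbourhood (n c k : ℕ) (2kc≤n : k * c + k * c ≤ n) where

  Near : ℕ → Set
  Near d = Multiple≤ k c d ⊎ Multiple≤ k c (n ∸ d)

  dist : Fin n → Fin n → ℕ
  dist x y = ∣ toℕ x - toℕ y ∣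

  dist<n : ∀ x y → dist x y < n
  dist<n x y = ≤-<-trans (∣m-n∣≤m⊔n (toℕ x) (toℕ y)) (⊔-lub (Finₚ.toℕ<n x) (Finₚ.toℕ<n y))

  cycDist≡⊓ : ∀ x y → cycDist n (toℕ x) (toℕ y) ≡ dist x y ⊓ (n ∸ dist x y)
  cycDist≡⊓ x y rewrite absDiff≡∣-∣ (toℕ x) (toℕ y) = min'≡⊓ _ _

  nbhd⇔Near : ∀ x y → T (inClosedNbhd n (multSet c k) x y) ⇔ Near (dist x y)
  nbhd⇔Near x y = mk⇔ to from
    where
    d = dist x y
    d' = n ∸ dist x y

    to : T (inClosedNbhd n (multSet c k) x y) → Near d
    to t with Equivalence.to T-∨ t
    ... | inj₁ x≡y = inj₁ (subst (Multiple≤ k c) (sym (m≡n⇒∣m-n∣≡0 (cong toℕ (toWitness x≡y))))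
                                 (Multiple≤-zero k c))
    ... | inj₂ adj with ⊓-sel d d'
                       | subst (Multiple≤ k c) (cycDist≡⊓ x y) (multSet⇒Multiple≤ c k _ adj)
    ...   | inj₁ e | m = inj₁ (subst (Multiple≤ k c) e m)
    ...   | inj₂ e | m = inj₂ (subst (Multiple≤ k c) e m)

    from : Near d → T (inClosedNbhd n (multSet c k) x y)
    from near with d ≟ 0
    ... | yes d≡0 = Equivalence.from T-∨ (inj₁ (fromWitness {a? = x Finₚ.≟ y}
                                             (Finₚ.toℕ-injective (∣m-n∣≡0⇒m≡n d≡0))))
    ... | no  d≢0 = Equivalence.from (T-∨ {⌊ x Finₚ.≟ y ⌋}) (inj₂ (Multiple≤⇒multSet c k _ 0<d⊓d' md⊓d'))
      where
      0<d⊓d' : 0 < cycDist n (toℕ x) (toℕ y)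
      0<d⊓d' = subst (0 <_) (sym (cycDist≡⊓ x y)) (⊓-mono-< (n≢0⇒n>0 d≢0) (m<n⇒0<n∸m (dist<n x y)))
      md⊓d' : Multiple≤ k c (cycDist n (toℕ x) (toℕ y))
      md⊓d' = subst (Multiple≤ k c) (sym (cycDist≡⊓ x y))
                (Multiple≤-⊓ (subst (k * c + k * c ≤_) (sym (m+[n∸m]≡n (<⇒≤ (dist<n x y)))) 2kc≤n) near)

module ShiftedNeighbourhood (n c k : ℕ) (0<c : 0 < c) (0<k : 0 < k) (2kc<n : k * c + k * c < n) where
  open ClosedNeighbourhood n c k (<⇒≤ 2kc<n)

  A B : ℕ
  A = c + k * c
  B = n ∸ k * c

  c≤kc : c ≤ k * c
  c≤kc = subst (_≤ k * c) (*-identityˡ c) (*-monoˡ-≤ c 0<k)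

  kc≤n : k * c ≤ n
  kc≤n = ≤-trans (m≤m+n (k * c) (k * c)) (<⇒≤ 2kc<n)

  kc<A : k * c < A
  kc<A = subst (k * c <_) (+-comm (k * c) c) (m<m+n (k * c) 0<c)

  kc<B : k * c < B
  kc<B = m+n≤o⇒m≤o∸n (suc (k * c)) 2kc<n

  c<B : c < B
  c<B = ≤-<-trans c≤kc kc<B

  A<n : A < n
  A<n = ≤-<-trans (+-monoˡ-≤ (k * c) c≤kc) 2kc<n

  B<n : B < n
  B<n = ∸-monoʳ-< (<-≤-trans 0<c c≤kc) kc≤n

  c<n : c < n
  c<n = ≤-<-trans (m≤m+n c (k * c)) A<n

  ≡B⇔ : ∀ {t} → t ≤ n → t ≡ B ⇔ n ∸ t ≡ k * c
  ≡B⇔ t≤n = mk⇔ (λ { refl → m∸[m∸n]≡n kc≤n })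
                (λ n∸t≡kc → trans (sym (m∸[m∸n]≡n t≤n)) (cong (n ∸_) n∸t≡kc))

  Multiple≤⇒≢B : ∀ {t} → Multiple≤ k c t → t ≢ B
  Multiple≤⇒≢B mt refl = <⇒≱ kc<B (Multiple≤-max mt)

  Near-c : Near c
  Near-c = inj₁ (1 , 0<k , sym (*-identityˡ c))

  Near-B : Near B
  Near-B = inj₂ (subst (Multiple≤ k c) (sym (Equivalence.to (≡B⇔ (m∸n≤m n (k * c))) refl)) (Multiple≤-top k c))

  Near-below-c : ∀ {d} → d < c → Near d → d ≡ 0
  Near-below-c d<c (inj₁ md) = Multiple≤-below d<c md
  Near-below-c {d} d<c (inj₂ md') = contradiction 2kc<n (≤⇒≯ (begin
    n                    ≤⟨ m≤n+m∸n n d ⟩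
    d + (n ∸ d)          ≤⟨ +-mono-≤ (<⇒≤ d<c) (Multiple≤-max md') ⟩
    c + k * c            ≤⟨ +-monoˡ-≤ (k * c) c≤kc ⟩
    k * c + k * c        ∎))
    where open ≤-Reasoning

  Near-A⇒A≡B : Near A → A ≡ B
  Near-A⇒A≡B (inj₁ mA) = contradiction (Multiple≤-max mA) (<⇒≱ kc<A)
  Near-A⇒A≡B (inj₂ mA') with n ∸ A ≟ k * c
  ... | yes e = Equivalence.from (≡B⇔ (<⇒≤ A<n)) e
  ... | no  e = contradiction 2kc<n (≤⇒≯ (begin
    n                        ≡⟨ m+[n∸m]≡n (<⇒≤ A<n) ⟨
    c + k * c + (n ∸ A)      ≡⟨ rearrange c (k * c) (n ∸ A) ⟩
    k * c + ((n ∸ A) + c)    ≤⟨ +-monoʳ-≤ (k * c) (Multiple≤-max (Multiple≤-+c⇐ mA' e)) ⟩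
    k * c + k * c            ∎))
    where
    open ≤-Reasoning
    rearrange : ∀ a b d → a + b + d ≡ b + (d + a)
    rearrange = solve-∀

  NearExchanged : ℕ → Set
  NearExchanged t = t ≡ A ⊎ (Near t × t ≢ B)

  Near[c∸t]⇔ : ∀ {t} → t < c → Near (c ∸ t) ⇔ NearExchanged t
  Near[c∸t]⇔ {t} t<c = mk⇔ (t≡0⇒rhs ∘ lhs⇒t≡0) (lhs⇐t≡0 ∘ rhs⇒t≡0)
    where
    lhs⇒t≡0 : Near (c ∸ t) → t ≡ 0
    lhs⇒t≡0 near with t ≟ 0
    ... | yes t≡0 = t≡0
    ... | no  t≢0 = contradiction (Near-below-c (∸-monoʳ-< (n≢0⇒n>0 t≢0) (<⇒≤ t<c)) near)
                                  (m>n⇒m∸n≢0 t<c)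
    lhs⇐t≡0 : t ≡ 0 → Near (c ∸ t)
    lhs⇐t≡0 refl = Near-c
    rhs⇒t≡0 : NearExchanged t → t ≡ 0
    rhs⇒t≡0 (inj₁ refl)       = contradiction t<c (≤⇒≯ (m≤m+n c (k * c)))
    rhs⇒t≡0 (inj₂ (near , _)) = Near-below-c t<c near
    t≡0⇒rhs : t ≡ 0 → NearExchanged t
    t≡0⇒rhs refl = inj₂ (inj₁ (Multiple≤-zero k c) , <⇒≢ (≤-<-trans z≤n c<B))

  Near[t∸c]⇔ : ∀ {t} → c ≤ t → t ≤ n → Near (t ∸ c) ⇔ NearExchanged t
  Near[t∸c]⇔ {t} c≤t t≤n = mk⇔ to from
    where
    s = t ∸ c
    t≡s+c : t ≡ s + c
    t≡s+c = sym (m∸n+n≡m c≤t)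
    n∸s≡n∸t+c : n ∸ s ≡ (n ∸ t) + c
    n∸s≡n∸t+c = m∸[n∸o]≡m∸n+o c≤t t≤n

    to : Near s → NearExchanged t
    to (inj₁ ms) with s ≟ k * c
    ... | yes s≡kc = inj₁ (trans t≡s+c (trans (cong (_+ c) s≡kc) (+-comm (k * c) c)))
    ... | no  s≢kc = inj₂ (inj₁ mt , Multiple≤⇒≢B mt)
      where mt = subst (Multiple≤ k c) (sym t≡s+c) (Multiple≤-+c⇐ ms s≢kc)
    to (inj₂ mn∸s) with Multiple≤-+c⇒ 0<c (subst (Multiple≤ k c) n∸s≡n∸t+c mn∸s)
    ... | mn∸t , n∸t≢kc = inj₂ (inj₂ mn∸t , n∸t≢kc ∘ Equivalence.to (≡B⇔ t≤n))

    from : NearExchanged t → Near s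
    from (inj₁ refl) = inj₁ (subst (Multiple≤ k c) (sym (m+n∸m≡n c (k * c))) (Multiple≤-top k c))
    from (inj₂ (inj₁ mt , _)) = inj₁ (proj₁ (Multiple≤-+c⇒ 0<c (subst (Multiple≤ k c) t≡s+c mt)))
    from (inj₂ (inj₂ mn∸t , t≢B)) =
      inj₂ (subst (Multiple≤ k c) (sym n∸s≡n∸t+c)
                  (Multiple≤-+c⇐ mn∸t (t≢B ∘ Equivalence.from (≡B⇔ t≤n))))

  Near∣c-t∣⇔ : ∀ {t} → t < n → Near ∣ c - t ∣ ⇔ NearExchanged t
  Near∣c-t∣⇔ {t} t<n with t <? c
  ... | yes t<c = subst (λ d → Near d ⇔ NearExchanged t) (sym (m≤n⇒∣n-m∣≡n∸m (<⇒≤ t<c)))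
                        (Near[c∸t]⇔ t<c)
  ... | no  t≮c = subst (λ d → Near d ⇔ NearExchanged t) (sym (m≤n⇒∣m-n∣≡n∸m (≮⇒≥ t≮c)))
                        (Near[t∸c]⇔ (≮⇒≥ t≮c) (<⇒≤ t<n))

  0<n : 0 < n
  0<n = <-trans 0<c c<n

  v₀ v_c : Fin n
  v₀  = fromℕ< 0<n
  v_c = fromℕ< c<n

  adj : Fin n → Fin n → Bool
  adj = inClosedNbhd n (multSet c k)

  nbhd-v₀ : ∀ y → T (adj v₀ y) ⇔ Near (toℕ y)
  nbhd-v₀ y = subst (λ z → T (adj v₀ y) ⇔ Near ∣ z - toℕ y ∣) (Finₚ.toℕ-fromℕ< 0<n) (nbhd⇔Near v₀ y)

  nbhd-v_c : ∀ y → T (adj v_c y) ⇔ Near ∣ c - toℕ y ∣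
  nbhd-v_c y = subst (λ z → T (adj v_c y) ⇔ Near ∣ z - toℕ y ∣) (Finₚ.toℕ-fromℕ< c<n) (nbhd⇔Near v_c y)

  balance : ∀ y v → (if adj v₀ y then v else 0) + (if toℕ y ≡ᵇ A then v else 0)
                  ≡ (if adj v_c y then v else 0) + (if toℕ y ≡ᵇ B then v else 0)
  balance y v = if-balance v swap y≡B⇒adj₀ y≡A⇒adj₀⇒y≡B
    where
    t = toℕ y
    swap : T (adj v_c y) ⇔ (T (t ≡ᵇ A) ⊎ (T (adj v₀ y) × ¬ T (t ≡ᵇ B)))
    swap = ⇔.trans (nbhd-v_c y) (⇔.trans (Near∣c-t∣⇔ (Finₚ.toℕ<n y))
             (⇔.sym (≡ᵇ⇔≡ ⊎-⇔ (nbhd-v₀ y ×-⇔ ¬-⇔ ≡ᵇ⇔≡))))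
    y≡B⇒adj₀ : T (t ≡ᵇ B) → T (adj v₀ y)
    y≡B⇒adj₀ t≡B = Equivalence.from (nbhd-v₀ y) (subst Near (sym (≡ᵇ⇒≡ t B t≡B)) Near-B)
    y≡A⇒adj₀⇒y≡B : T (t ≡ᵇ A) → T (adj v₀ y) → T (t ≡ᵇ B)
    y≡A⇒adj₀⇒y≡B t≡ᵇA a = ≡⇒≡ᵇ t B (trans t≡A (Near-A⇒A≡B (subst Near t≡A (Equivalence.to (nbhd-v₀ y) a))))
      where t≡A = ≡ᵇ⇒≡ t A t≡ᵇA

  magic⇒A≡B : ∀ ℓ k' → HasMagicConstant n (multSet c k) ℓ k' → A ≡ B
  magic⇒A≡B ℓ k' magic = begin
    A                   ≡⟨ Finₚ.toℕ-fromℕ< A<n ⟨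
    toℕ (fromℕ< A<n)    ≡⟨ cong toℕ (Bijection.injective ℓ (Finₚ.toℕ-injective (suc-injective fA≡fB))) ⟩
    toℕ (fromℕ< B<n)    ≡⟨ Finₚ.toℕ-fromℕ< B<n ⟩
    B                   ∎
    where
    open ≡-Reasoning
    f : Fin n → ℕ
    f y = suc (toℕ (Bijection.to ℓ y))
    S : Fin n → ℕ
    S = closedNbhdSum n (multSet c k) ℓ
    [_∈N[_]] : Fin n → Fin n → ℕ
    [ y ∈N[ x ]] = if adj x y then f y else 0
    [_≡_] : Fin n → ℕ → ℕ
    [ y ≡ a ] = if toℕ y ≡ᵇ a then f y else 0
    sums : S v₀ + f (fromℕ< A<n) ≡ S v_c + f (fromℕ< B<n)
    sums = begin
      S v₀ + f (fromℕ< A<n)                       ≡⟨ cong (S v₀ +_) (ΣFin-indicator n A A<n f) ⟨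
      S v₀ + ΣFin n [_≡ A ]                        ≡⟨ ∑-distrib-+ [_∈N[ v₀ ]] [_≡ A ] ⟨
      ΣFin n (λ y → [ y ∈N[ v₀ ]] + [ y ≡ A ])      ≡⟨ sum-cong-≗ (λ y → balance y (f y)) ⟩
      ΣFin n (λ y → [ y ∈N[ v_c ]] + [ y ≡ B ])     ≡⟨ ∑-distrib-+ [_∈N[ v_c ]] [_≡ B ] ⟩
      S v_c + ΣFin n [_≡ B ]                       ≡⟨ cong (S v_c +_) (ΣFin-indicator n B B<n f) ⟩
      S v_c + f (fromℕ< B<n)                       ∎
    fA≡fB : f (fromℕ< A<n) ≡ f (fromℕ< B<n)
    fA≡fB = +-cancelˡ-≡ k' _ _
              (subst₂ (λ p q → p + f (fromℕ< A<n) ≡ q + f (fromℕ< B<n)) (magic v₀) (magic v_c) sums)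

  magic⇒n≡[2k+1]c : ∀ ℓ k' → HasMagicConstant n (multSet c k) ℓ k' → n ≡ (2 * k + 1) * c
  magic⇒n≡[2k+1]c ℓ k' magic = begin
    n                    ≡⟨ m∸n+n≡m kc≤n ⟨
    B + k * c            ≡⟨ cong (_+ k * c) (magic⇒A≡B ℓ k' magic) ⟨
    c + k * c + k * c    ≡⟨ expand k c ⟩
    (2 * k + 1) * c      ∎
    where
    open ≡-Reasoning
    expand : ∀ k c → c + k * c + k * c ≡ (2 * k + 1) * c
    expand = solve-∀

SameResidueNbhds : (n c : ℕ) .{{_ : NonZero c}} → (ℕ → Bool) → Set
SameResidueNbhds n c S = ∀ x y → inClosedNbhd n S x y ≡ (toℕ x % c ≡ᵇ toℕ y % c)

module ResidueNeighbourhood (n c k : ℕ) .{{_ : NonZero c}} (2kc≤n : k * c + k * c ≤ n)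
                            (m : ℕ) (m≤2k+1 : m ≤ 2 * k + 1) (n≡mc : n ≡ m * c) where
  open ClosedNeighbourhood n c k 2kc≤n

  Near⇔∣ : ∀ {d} → d ≤ n → Near d ⇔ c ∣ d
  Near⇔∣ {d} d≤n = mk⇔ to from
    where
    to : Near d → c ∣ d
    to (inj₁ (q , _ , d≡qc))   = divides q d≡qc
    to (inj₂ (q , _ , n∸d≡qc)) =
      ∣m+n∣m⇒∣n (subst (c ∣_) (sym (m∸n+n≡m d≤n)) (divides m n≡mc)) (divides q n∸d≡qc)
    from : c ∣ d → Near d
    from (divides q d≡qc) with q ≤? k
    ... | yes q≤k = inj₁ (q , q≤k , d≡qc)
    ... | no  q≰k = inj₂ (m ∸ q , m∸q≤k , trans (cong₂ _∸_ n≡mc d≡qc) (sym (*-distribʳ-∸ c m q)))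
      where
      split : ∀ k → 2 * k + 1 ≡ suc k + k
      split = solve-∀
      m∸q≤k : m ∸ q ≤ k
      m∸q≤k = subst (m ∸ q ≤_) (trans (cong (_∸ suc k) (split k)) (m+n∸m≡n (suc k) k))
                (∸-mono m≤2k+1 (≰⇒> q≰k))

  sameResidueNbhds : SameResidueNbhds n c (multSet c k)
  sameResidueNbhds x y = T-injective (⇔.trans (nbhd⇔Near x y) (⇔.trans (Near⇔∣ (<⇒≤ (dist<n x y)))
                           (⇔.trans (∣∣-∣⇔%≡% c (toℕ x) (toℕ y)) (⇔.sym ≡ᵇ⇔≡))))

residueMagic⇒2ck'≡n[n+1] : ∀ n c .{{_ : NonZero c}} S → c ≤ n → SameResidueNbhds n c S →
                           ∀ ℓ k' → HasMagicConstant n S ℓ k' → 2 * (c * k') ≡ n * suc n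
residueMagic⇒2ck'≡n[n+1] n c S c≤n sameResidue ℓ k' magic = trans (cong (2 *_) c*k'≡) (2*ΣFin[1+i]≡n[1+n] n)
  where
  f : Fin n → ℕ
  f y = suc (toℕ (Bijection.to ℓ y))
  v : Fin c → Fin n
  v r = Fin.inject≤ r c≤n
  [_∈N[_]] : Fin n → Fin c → ℕ
  [ y ∈N[ r ]] = if inClosedNbhd n S (v r) y then f y else 0
  column : ∀ y → ΣFin c [ y ∈N[_]] ≡ f y
  column y = trans (sum-cong-≗ λ r → cong (λ b → if b then f y else 0) (begin
      inClosedNbhd n S (v r) y         ≡⟨ sameResidue (v r) y ⟩
      toℕ (v r) % c ≡ᵇ toℕ y % c       ≡⟨ cong (λ a → a % c ≡ᵇ toℕ y % c) (Finₚ.toℕ-inject≤ r c≤n) ⟩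
      toℕ r % c ≡ᵇ toℕ y % c           ≡⟨ cong (_≡ᵇ toℕ y % c) (m<n⇒m%n≡m (Finₚ.toℕ<n r)) ⟩
      toℕ r ≡ᵇ toℕ y % c               ∎))
    (ΣFin-indicator c (toℕ y % c) (m%n<n (toℕ y) c) (λ _ → f y))
    where open ≡-Reasoning
  c*k'≡ : c * k' ≡ ΣFin n (λ y → suc (toℕ y))
  c*k'≡ = begin
    c * k'                                     ≡⟨ ΣFin-const c k' ⟨
    ΣFin c (λ r → k')                          ≡⟨ sum-cong-≗ (magic ∘ v) ⟨
    ΣFin c (λ r → ΣFin n [_∈N[ r ]])           ≡⟨ ∑-comm (λ r y → [ y ∈N[ r ]]) ⟩
    ΣFin n (λ y → ΣFin c [ y ∈N[_]])           ≡⟨ sum-cong-≗ column ⟩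
    ΣFin n f                                   ≡⟨ ΣFin-bijection n ℓ (λ y → suc (toℕ y)) ⟩
    ΣFin n (λ y → suc (toℕ y))                 ∎
    where open ≡-Reasoning

2ck'≡n[n+1]⇒c-odd : ∀ c k k' .{{_ : NonZero c}} →
  2 * (c * k') ≡ (2 * k + 1) * c * suc ((2 * k + 1) * c) → c % 2 ≡ 1
2ck'≡n[n+1]⇒c-odd c k k' eq with c % 2 in c%2 | m%n<n c 2
... | 1           | _ = refl
... | suc (suc _) | s≤s (s≤s ())
... | 0           | _ = contradiction (*-cancelˡ-≡ (2 * k') _ c c*2k'≡c*odd)
                                      (even≢odd k' ((2 * k + 1) * (2 * k + 1) * h + k))
  where
  h = c / 2
  c≡2h : c ≡ 2 * h
  c≡2h = trans (m≡m%n+[m/n]*n c 2) (trans (cong (_+ h * 2) c%2) (*-comm h 2))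
  c*2k'≡c*odd : c * (2 * k') ≡ c * suc (2 * ((2 * k + 1) * (2 * k + 1) * h + k))
  c*2k'≡c*odd = begin
    c * (2 * k')                                      ≡⟨ regroup c k' ⟩
    2 * (c * k')                                      ≡⟨ eq ⟩
    (2 * k + 1) * c * suc ((2 * k + 1) * c)           ≡⟨ factor c k ⟩
    c * ((2 * k + 1) * suc ((2 * k + 1) * c))         ≡⟨ cong (λ z → c * ((2 * k + 1) * suc ((2 * k + 1) * z))) c≡2h ⟩
    c * ((2 * k + 1) * suc ((2 * k + 1) * (2 * h)))   ≡⟨ cong (c *_) (expand k h) ⟩
    c * suc (2 * ((2 * k + 1) * (2 * k + 1) * h + k)) ∎
    where
    open ≡-Reasoning
    regroup : ∀ c k' → c * (2 * k') ≡ 2 * (c * k')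
    regroup = solve-∀
    factor : ∀ c k → (2 * k + 1) * c * suc ((2 * k + 1) * c) ≡ c * ((2 * k + 1) * suc ((2 * k + 1) * c))
    factor = solve-∀
    expand : ∀ k h → (2 * k + 1) * suc ((2 * k + 1) * (2 * h)) ≡ suc (2 * ((2 * k + 1) * (2 * k + 1) * h + k))
    expand = solve-∀

record KotzigArray (m c : ℕ) : Set where
  field
    row           : Fin m → Fin c → Fin c
    row-injective : ∀ j → Injective _≡_ _≡_ (row j)
    columnSum     : ℕ
    column-sum    : ∀ s → ΣFin m (λ j → toℕ (row j s)) ≡ columnSum

toℕ-combine-% : ∀ {m c} .{{_ : NonZero c}} (j : Fin m) (s : Fin c) → toℕ (combine j s) % c ≡ toℕ s
toℕ-combine-% {c = c} j s = begin
  toℕ (combine j s) % c      ≡⟨ cong (_% c) (Finₚ.toℕ-combine j s) ⟩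
  (c * toℕ j + toℕ s) % c    ≡⟨ %-remove-+ˡ (toℕ s) (divides (toℕ j) (*-comm c (toℕ j))) ⟩
  toℕ s % c                  ≡⟨ m<n⇒m%n≡m (Finₚ.toℕ<n s) ⟩
  toℕ s                      ∎
  where open ≡-Reasoning

module KotzigLabelling {m c : ℕ} .{{_ : NonZero c}} (K : KotzigArray m c) where
  open KotzigArray K

  relabel : Fin (m * c) → Fin (m * c)
  relabel = uncurry (λ j s → combine j (row j s)) ∘ remQuot c

  relabel-combine : ∀ j s → relabel (combine j s) ≡ combine j (row j s)
  relabel-combine j s = cong (uncurry (λ j s → combine j (row j s))) (Finₚ.remQuot-combine j s)

  relabel-injective : Injective _≡_ _≡_ relabel
  relabel-injective {x} {y} eq = begin
    x                                 ≡⟨ Finₚ.combine-remQuot {m} c x ⟨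
    uncurry combine (remQuot {m} c x) ≡⟨ combine-row-injective _ _ _ _ eq ⟩
    uncurry combine (remQuot {m} c y) ≡⟨ Finₚ.combine-remQuot {m} c y ⟩
    y                                 ∎
    where
    open ≡-Reasoning
    combine-row-injective : ∀ j s j' s' → combine j (row j s) ≡ combine j' (row j' s') →
                            combine j s ≡ combine j' s'
    combine-row-injective j s j' s' eq with refl ← Finₚ.combine-injectiveˡ j (row j s) j' (row j' s') eq =
      cong (combine j) (row-injective j (Finₚ.combine-injectiveʳ j (row j s) j (row j s') eq))

  labelling : Fin (m * c) ⤖ Fin (m * c)
  labelling = mk⤖ (relabel-injective , λ y → Product.map₂ (λ e z≡x → trans (cong relabel z≡x) e)
                                                         (Fin-injective⇒surjective relabel relabel-injective y))

  magicConstant : ℕ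
  magicConstant = ΣFin m (λ j → suc (c * toℕ j)) + columnSum

  hasMagicConstant : ∀ S → SameResidueNbhds (m * c) c S → HasMagicConstant (m * c) S labelling magicConstant
  hasMagicConstant S sameResidue x = begin
    closedNbhdSum (m * c) S labelling x
      ≡⟨ ΣFin-combine m c _ ⟩
    ΣFin m (λ j → ΣFin c (λ s → if adj (combine j s) then suc (toℕ (relabel (combine j s))) else 0))
      ≡⟨ sum-cong-≗ (λ j → sum-cong-≗ (λ s → cong₂ (λ b v → if b then suc v else 0)
                                                    (adj-combine j s) (toℕ-relabel-combine j s))) ⟩
    ΣFin m (λ j → ΣFin c (λ s → if toℕ s ≡ᵇ r then suc (c * toℕ j + toℕ (row j s)) else 0))
      ≡⟨ sum-cong-≗ (λ j → ΣFin-indicator c r r<c (λ s → suc (c * toℕ j + toℕ (row j s)))) ⟩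
    ΣFin m (λ j → suc (c * toℕ j) + toℕ (row j (fromℕ< r<c)))
      ≡⟨ ∑-distrib-+ (λ j → suc (c * toℕ j)) (λ j → toℕ (row j (fromℕ< r<c))) ⟩
    ΣFin m (λ j → suc (c * toℕ j)) + ΣFin m (λ j → toℕ (row j (fromℕ< r<c)))
      ≡⟨ cong (ΣFin m (λ j → suc (c * toℕ j)) +_) (column-sum (fromℕ< r<c)) ⟩
    magicConstant ∎
    where
    open ≡-Reasoning
    r = toℕ x % c
    r<c = m%n<n (toℕ x) c
    adj = inClosedNbhd (m * c) S x
    adj-combine : ∀ j s → adj (combine j s) ≡ (toℕ s ≡ᵇ r)
    adj-combine j s = trans (sameResidue x (combine j s))
                            (trans (cong (r ≡ᵇ_) (toℕ-combine-% j s)) (≡ᵇ-comm r (toℕ s)))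
    toℕ-relabel-combine : ∀ j s → toℕ (relabel (combine j s)) ≡ c * toℕ j + toℕ (row j s)
    toℕ-relabel-combine j s = trans (cong toℕ (relabel-combine j s)) (Finₚ.toℕ-combine j (row j s))

  magicConstant>0 : 0 < m → 0 < magicConstant
  magicConstant>0 (s≤s _) = z<s

  closedDistanceMagic : 0 < m → ∀ S → SameResidueNbhds (m * c) c S → ClosedDistanceMagic (m * c) S
  closedDistanceMagic 0<m S sameResidue = labelling , magicConstant , magicConstant>0 0<m , hasMagicConstant S sameResidue

toℕ+toℕ-opposite : ∀ {c} (s : Fin c) → toℕ s + toℕ (opposite s) ≡ pred c
toℕ+toℕ-opposite {suc c} s =
  trans (cong (toℕ s +_) (Finₚ.opposite-prop s)) (m+[n∸m]≡n (Finₚ.toℕ≤pred[n] s))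

opposite-injective : ∀ {c} → Injective _≡_ _≡_ (opposite {c})
opposite-injective {x = a} {b} eq =
  trans (sym (Finₚ.opposite-involutive a)) (trans (cong opposite eq) (Finₚ.opposite-involutive b))

KotzigArray-empty : ∀ {c} → KotzigArray 0 c
KotzigArray-empty = record { row = λ (); row-injective = λ (); columnSum = 0; column-sum = λ _ → refl }

KotzigArray-+2 : ∀ {m c} → KotzigArray m c → KotzigArray (2 + m) c
KotzigArray-+2 {m} {c} K = record
  { row           = row′
  ; row-injective = row′-injective
  ; columnSum     = pred c + columnSum
  ; column-sum    = λ s → trans (sym (+-assoc (toℕ s) _ _)) (cong₂ _+_ (toℕ+toℕ-opposite s) (column-sum s))
  }
  where
  open KotzigArray K
  row′ : Fin (2 + m) → Fin c → Fin c
  row′ Fin.zero              = id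
  row′ (Fin.suc Fin.zero)    = opposite
  row′ (Fin.suc (Fin.suc j)) = row j
  row′-injective : ∀ j → Injective _≡_ _≡_ (row′ j)
  row′-injective Fin.zero              = id
  row′-injective (Fin.suc Fin.zero)    = opposite-injective
  row′-injective (Fin.suc (Fin.suc j)) = row-injective j

KotzigArray-+2* : ∀ {m c} i → KotzigArray m c → KotzigArray (2 * i + m) c
KotzigArray-+2* zero    K = K
KotzigArray-+2* {m} {c} (suc i) K =
  subst (λ m′ → KotzigArray m′ c) (regroup i m) (KotzigArray-+2 (KotzigArray-+2* i K))
  where
  regroup : ∀ i m → 2 + (2 * i + m) ≡ 2 * suc i + m
  regroup = solve-∀

KotzigArray-even : ∀ k c → KotzigArray (2 * k) c
KotzigArray-even k c = subst (λ m → KotzigArray m c) (+-identityʳ (2 * k)) (KotzigArray-+2* k KotzigArray-empty)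

module ThreeRowKotzigArray (h : ℕ) where
  c : ℕ
  c = suc (h + h)

  data Half : ℕ → Set where
    lower : ∀ s d → s + d ≡ h → Half s
    upper : ∀ u d → suc u + d ≡ h → Half (suc h + u)

  half : ∀ s → s < c → Half s
  half s s<c with s ≤? h
  ... | yes s≤h = lower s (h ∸ s) (m+[n∸m]≡n s≤h)
  ... | no  s≰h = subst Half (m+[n∸m]≡n (≰⇒> s≰h)) (upper u (h ∸ suc u) (m+[n∸m]≡n u<h))
    where
    u = s ∸ suc h
    u<h : u < h
    u<h = subst (u <_) (m+n∸m≡n (suc h) h) (∸-monoˡ-< s<c (≰⇒> s≰h))

  view : (s : Fin c) → Half (toℕ s)
  view s = half (toℕ s) (Finₚ.toℕ<n s)

  rotated : ∀ {s} → Half s → ℕ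
  rotated (lower s _ _) = s + h
  rotated (upper u _ _) = u

  complement : ∀ {s} → Half s → ℕ
  complement (lower _ d _) = 2 * d
  complement (upper _ d _) = suc (2 * d)

  rotated<c : ∀ {s} (v : Half s) → rotated v < c
  rotated<c (lower s d refl) = s≤s (+-monoˡ-≤ (s + d) (m≤m+n s d))
  rotated<c (upper u d refl) = ≤-trans (m≤m+n (suc u) d) (m≤n⇒m≤1+n (m≤m+n (suc u + d) (suc u + d)))

  complement<c : ∀ {s} (v : Half s) → complement v < c
  complement<c (lower s d refl) = s≤s (+-mono-≤ (m≤n+m d s) (subst (_≤ s + d) (sym (+-identityʳ d)) (m≤n+m d s)))
  complement<c (upper u d refl) =
    s≤s (+-mono-<-≤ (m<n+m d z<s) (subst (_≤ suc u + d) (sym (+-identityʳ d)) (m≤n+m d (suc u))))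

  rotated-injective : ∀ {s s'} (v : Half s) (v' : Half s') → rotated v ≡ rotated v' → s ≡ s'
  rotated-injective (lower s _ _) (lower s' _ _) eq = +-cancelʳ-≡ h s s' eq
  rotated-injective (upper u _ _) (upper u' _ _) eq = cong (suc h +_) eq
  rotated-injective (lower s _ _) (upper u' d' refl) eq = contradiction (subst (suc u' + d' ≤_) eq (m≤n+m _ s))
                                                                        (<⇒≱ (m≤m+n (suc u') d'))
  rotated-injective (upper u d refl) (lower s' _ _) eq = contradiction (subst (suc u + d ≤_) (sym eq) (m≤n+m _ s'))
                                                                       (<⇒≱ (m≤m+n (suc u) d))

  complement-injective : ∀ {s s'} (v : Half s) (v' : Half s') → complement v ≡ complement v' → s ≡ s'
  complement-injective (lower s d e) (lower s' d' e') eq with refl ← *-cancelˡ-≡ d d' 2 eq =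
    +-cancelʳ-≡ d s s' (trans e (sym e'))
  complement-injective (upper u d e) (upper u' d' e') eq with refl ← *-cancelˡ-≡ d d' 2 (suc-injective eq) =
    cong (suc h +_) (suc-injective (+-cancelʳ-≡ d (suc u) (suc u') (trans e (sym e'))))
  complement-injective (lower _ d _) (upper _ d' _) eq = contradiction eq (even≢odd d d')
  complement-injective (upper _ d _) (lower _ d' _) eq = contradiction (sym eq) (even≢odd d' d)

  row-sum : ∀ {s} (v : Half s) → s + (rotated v + complement v) ≡ h + (h + h)
  row-sum (lower s d refl) = regroup s d
    where regroup : ∀ s d → s + ((s + (s + d)) + 2 * d) ≡ (s + d) + ((s + d) + (s + d))
          regroup = solve-∀
  row-sum (upper u d refl) = regroup u d
    where regroup : ∀ u d → suc (suc u + d) + u + (u + suc (2 * d)) ≡ (suc u + d) + ((suc u + d) + (suc u + d))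
          regroup = solve-∀

  module LiftRow (f : ∀ {s} → Half s → ℕ) (f<c : ∀ {s} (v : Half s) → f v < c)
                 (f-injective : ∀ {s s'} (v : Half s) (v' : Half s') → f v ≡ f v' → s ≡ s') where
    liftRow : Fin c → Fin c
    liftRow s = fromℕ< (f<c (view s))

    toℕ-liftRow : ∀ s → toℕ (liftRow s) ≡ f (view s)
    toℕ-liftRow s = Finₚ.toℕ-fromℕ< _

    liftRow-injective : Injective _≡_ _≡_ liftRow
    liftRow-injective {a} {b} eq = Finₚ.toℕ-injective (f-injective _ _
      (trans (sym (toℕ-liftRow a)) (trans (cong toℕ eq) (toℕ-liftRow b))))

  open LiftRow rotated rotated<c rotated-injective using ()
    renaming (liftRow to rotate; toℕ-liftRow to toℕ-rotate; liftRow-injective to rotate-injective)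
  open LiftRow complement complement<c complement-injective using ()
    renaming (liftRow to complementRow; toℕ-liftRow to toℕ-complementRow; liftRow-injective to complementRow-injective)

  kotzigArray : KotzigArray 3 c
  kotzigArray = record
    { row           = row
    ; row-injective = row-injective
    ; columnSum     = h + (h + h)
    ; column-sum    = column-sum
    }
    where
    row : Fin 3 → Fin c → Fin c
    row Fin.zero                     = id
    row (Fin.suc Fin.zero)           = rotate
    row (Fin.suc (Fin.suc Fin.zero)) = complementRow
    row-injective : ∀ j → Injective _≡_ _≡_ (row j)
    row-injective Fin.zero                     = id
    row-injective (Fin.suc Fin.zero)           = rotate-injective
    row-injective (Fin.suc (Fin.suc Fin.zero)) = complementRow-injective
    column-sum : ∀ s → ΣFin 3 (λ j → toℕ (row j s)) ≡ h + (h + h)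
    column-sum s rewrite toℕ-rotate s | toℕ-complementRow s | +-identityʳ (complement (view s)) = row-sum (view s)

KotzigArray-odd : ∀ k h → 0 < k → KotzigArray (2 * k + 1) (suc (h + h))
KotzigArray-odd (suc k) h _ =
  subst (λ m → KotzigArray m (suc (h + h))) (regroup k) (KotzigArray-+2* k (ThreeRowKotzigArray.kotzigArray h))
  where
  regroup : ∀ k → 2 * k + 3 ≡ 2 * suc k + 1
  regroup = solve-∀

Shape : ℕ → ℕ → ℕ → Set
Shape n c k = (n ≡ 2 * k * c) ⊎ ((n ≡ (2 * k + 1) * c) × (c % 2 ≡ 1))

closedDistanceMagic⇒shape : ∀ n c k → 0 < c → 0 < k → k * c + k * c ≤ n →
                            ClosedDistanceMagic n (multSet c k) → Shape n c k
closedDistanceMagic⇒shape n c k 0<c 0<k 2kc≤n (ℓ , k' , _ , magic) with n ≟ 2 * k * c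
... | yes n≡2kc = inj₁ n≡2kc
... | no  n≢2kc =
  inj₂ (n≡[2k+1]c , 2ck'≡n[n+1]⇒c-odd c k k' (subst (λ z → 2 * (c * k') ≡ z * suc z) n≡[2k+1]c counted))
  where
  instance _ = >-nonZero 0<c
  twice : ∀ k c → k * c + k * c ≡ 2 * k * c
  twice = solve-∀
  2kc<n : k * c + k * c < n
  2kc<n = ≤∧≢⇒< 2kc≤n (λ 2kc≡n → n≢2kc (trans (sym 2kc≡n) (twice k c)))
  open ShiftedNeighbourhood n c k 0<c 0<k 2kc<n using (magic⇒n≡[2k+1]c; c<n)
  n≡[2k+1]c = magic⇒n≡[2k+1]c ℓ k' magic
  counted = residueMagic⇒2ck'≡n[n+1] n c (multSet c k) (<⇒≤ c<n)
              (ResidueNeighbourhood.sameResidueNbhds n c k 2kc≤n (2 * k + 1) ≤-refl n≡[2k+1]c) ℓ k' magic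

shape⇒closedDistanceMagic : ∀ n c k → 0 < c → 0 < k → Shape n c k → ClosedDistanceMagic n (multSet c k)
shape⇒closedDistanceMagic _ c k 0<c 0<k (inj₁ refl) =
  KotzigLabelling.closedDistanceMagic (KotzigArray-even k c) (*-monoʳ-< 2 0<k) (multSet c k)
    (ResidueNeighbourhood.sameResidueNbhds (2 * k * c) c k (≤-reflexive (twice k c)) (2 * k) (m≤m+n (2 * k) 1) refl)
  where
  instance _ = >-nonZero 0<c
  twice : ∀ k c → k * c + k * c ≡ 2 * k * c
  twice = solve-∀
shape⇒closedDistanceMagic _ c k 0<c 0<k (inj₂ (refl , c-odd)) =
  subst (λ c → ClosedDistanceMagic ((2 * k + 1) * c) (multSet c k)) (sym c≡2h+1)
    (KotzigLabelling.closedDistanceMagic (KotzigArray-odd k h 0<k) (m≤n+m 1 (2 * k)) (multSet (suc (h + h)) k)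
      (ResidueNeighbourhood.sameResidueNbhds ((2 * k + 1) * suc (h + h)) (suc (h + h)) k
        (bound k (suc (h + h))) (2 * k + 1) ≤-refl refl))
  where
  h = c / 2
  twice : ∀ h → h * 2 ≡ h + h
  twice = solve-∀
  c≡2h+1 : c ≡ suc (h + h)
  c≡2h+1 = trans (m≡m%n+[m/n]*n c 2) (trans (cong (_+ h * 2) c-odd) (cong suc (twice h)))
  regroup : ∀ k c → k * c + k * c + c ≡ (2 * k + 1) * c
  regroup = solve-∀
  bound : ∀ k c → k * c + k * c ≤ (2 * k + 1) * c
  bound k c = subst (k * c + k * c ≤_) (regroup k c) (m≤m+n (k * c + k * c) c)

mainTheorem3 : (n c k : ℕ) → 0 < n → 0 < c → 0 < k → k * c ≤ n / 2 →
    ClosedDistanceMagic n (multSet c k)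
      ⇔ ((n ≡ 2 * k * c) ⊎ ((n ≡ (2 * k + 1) * c) × (c % 2 ≡ 1)))
mainTheorem3 n c k _ 0<c 0<k kc≤n/2 =
  mk⇔ (closedDistanceMagic⇒shape n c k 0<c 0<k 2kc≤n) (shape⇒closedDistanceMagic n c k 0<c 0<k)
  where
  twice : ∀ a → a + a ≡ a * 2
  twice = solve-∀
  2kc≤n : k * c + k * c ≤ n
  2kc≤n = ≤-trans (+-mono-≤ kc≤n/2 kc≤n/2) (≤-trans (≤-reflexive (twice (n / 2))) (m/n*n≤m n 2))
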